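{- Let $m>1$ and $n\ge 1$ be integers and let $\lambda\in SP(n,m)$. If $m\mid n$, then every part of $\lambda$ is a multiple of $m$. If $n\equiv r\pmod m$ with $1\le r<m$, then $\lambda$ contains exactly one part congruent to $r$ modulo $m$.
   Context: Fix an integer $m>1$. Sets $SP(n,m)$ of compositions of $n$ (semi-$m$-Pell compositions) are defined recursively: $SP(n,m)=\{(n)\}$ for $1\le n\le m$; if $n>m$ and $m\mid n$, $SP(n,m)$ consists of the compositions in $SP(n/m,m)$ with every part multiplied by $m$; if $n>m$ and $n\equiv r\pmod m$ with $1\le r\le m-1$, then $SP(n,m)$ consists of the compositions obtained by inserting a part $r$ at the beginning or at the end of each composition in $SP(n-r,m)$, together with the compositions obtained from each composition in $SP(n-m,m)$ by adding $m$ to its part that is congruent to $r$ modulo $m$. -}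

module Defs where

open import Data.Nat using (ℕ; _+_; _*_; _∸_; _≤_; _<_; NonZero)
open import Data.Nat.DivMod using (_%_; _/_)
open import Data.List using (List; []; _∷_; _++_; [_]; map)
open import Relation.Binary.PropositionalEquality using (_≡_; _≢_)

-- SP m n λ : the composition λ (a list of positive parts) belongs to SP(n,m),
-- the semi-m-Pell compositions of n.
data SP (m : ℕ) .{{_ : NonZero m}} : ℕ → List ℕ → Set where
  base  : ∀ {n} → 1 ≤ n → n ≤ m → SP m n [ n ]
  scale : ∀ {n λ′} → m < n → n % m ≡ 0 → SP m (n / m) λ′ →
          SP m n (map (m *_) λ′)
  consL : ∀ {n λ′} → m < n → n % m ≢ 0 → SP m (n ∸ n % m) λ′ →
          SP m n (n % m ∷ λ′)
  consR : ∀ {n λ′} → m < n → n % m ≢ 0 → SP m (n ∸ n % m) λ′ →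
          SP m n (λ′ ++ [ n % m ])
  addm  : ∀ {n} xs x ys → m < n → n % m ≢ 0 → SP m (n ∸ m) (xs ++ x ∷ ys) →
          x % m ≡ n % m → SP m n (xs ++ (x + m) ∷ ys)

module Submission where

-- If m ∣ n, the composition is either the
-- one-part composition (n) or a scaled one, so all parts are multiples of m. If n ≡ r ≢ 0,
-- inserting r next to a composition of the multiple n − r of m adds the only part of residue r,
-- and adding m to the part of residue r in a composition of n − m keeps its residue.

open import Defs
open import Data.Nat using (ℕ; _≤_; _<_; NonZero; _≟_; _+_; _*_; _∸_)
open import Data.Nat.DivMod
  using (_%_; _/_; m≡m%n+[m/n]*n; m%n%n≡m%n; [m+n]%n≡m%n; m≤n⇒[n∸m]%m≡n%m)
open import Data.Nat.Divisibility using (_∣_; divides; m∣m*n; n∣m⇒m%n≡0)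
open import Data.Nat.Properties using (m+n∸m≡n; m<n⇒n≢0; <⇒≤)
open import Data.List using (List; _∷_; _++_; [_]; length; filter)
open import Data.List.Properties using (length-++; filter-++; filter-none; filter-accept; filter-reject)
open import Data.List.Relation.Unary.All using (All; []; _∷_; universal)
import Data.List.Relation.Unary.All as All
open import Data.List.Relation.Unary.All.Properties using (map⁺)
open import Data.Product using (_×_; _,_)
open import Function using (_∘_; _⇔_; mk⇔; Equivalence)
open import Relation.Nullary using (yes; no; contradiction)
open import Relation.Unary using (Pred; Decidable; ∁)
open import Relation.Binary.PropositionalEquality using (_≡_; _≢_; refl; sym; trans; cong; cong₂; module ≡-Reasoning)

module _ {a p} {A : Set a} {P : Pred A p} (P? : Decidable P) where

  count : List A → ℕ
  count xs = length (filter P? xs)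

  count-++ : ∀ xs ys → count (xs ++ ys) ≡ count xs + count ys
  count-++ xs ys = trans (cong length (filter-++ P? xs ys)) (length-++ (filter P? xs))

  count-none : ∀ {xs} → All (∁ P) xs → count xs ≡ 0
  count-none = cong length ∘ filter-none P?

  count-singleton : ∀ {x} → P x → count [ x ] ≡ 1
  count-singleton = cong length ∘ filter-accept P?

  count-∷-cong : ∀ {x y} ys → P x ⇔ P y → count (x ∷ ys) ≡ count (y ∷ ys)
  count-∷-cong {x} ys Px⇔Py with P? x
  ... | yes Px = sym (cong length (filter-accept P? (Equivalence.to Px⇔Py Px)))
  ... | no ¬Px = sym (cong length (filter-reject P? (¬Px ∘ Equivalence.from Px⇔Py)))

  count-replace : ∀ xs {x y} ys → P x ⇔ P y → count (xs ++ x ∷ ys) ≡ count (xs ++ y ∷ ys)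
  count-replace xs {x} {y} ys Px⇔Py = begin
    count (xs ++ x ∷ ys)      ≡⟨ count-++ xs (x ∷ ys) ⟩
    count xs + count (x ∷ ys) ≡⟨ cong (count xs +_) (count-∷-cong ys Px⇔Py) ⟩
    count xs + count (y ∷ ys) ≡⟨ count-++ xs (y ∷ ys) ⟨
    count (xs ++ y ∷ ys)      ∎
    where open ≡-Reasoning

module _ {m : ℕ} .{{_ : NonZero m}} where

  hasResidue? : ∀ r → Decidable (λ x → x % m ≡ r)
  hasResidue? r x = x % m ≟ r

  residueCount : ℕ → List ℕ → ℕ
  residueCount r = count (hasResidue? r)

  residue-cong : ∀ {x y r} → x % m ≡ y % m → (x % m ≡ r) ⇔ (y % m ≡ r)
  residue-cong x≡y = mk⇔ (trans (sym x≡y)) (trans x≡y)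

  m∣n∸n%m : ∀ n → m ∣ n ∸ n % m
  m∣n∸n%m n = divides (n / m) (begin
    n ∸ n % m                   ≡⟨ cong (_∸ n % m) (m≡m%n+[m/n]*n n m) ⟩
    n % m + n / m * m ∸ n % m   ≡⟨ m+n∸m≡n (n % m) (n / m * m) ⟩
    n / m * m                   ∎)
    where open ≡-Reasoning

  residueCount-multiples : ∀ {r xs} → r ≢ 0 → All (m ∣_) xs → residueCount r xs ≡ 0
  residueCount-multiples r≢0 = count-none (hasResidue? _) ∘ All.map avoids-r
    where
    avoids-r : ∀ {x} → m ∣ x → x % m ≢ _
    avoids-r m∣x x%m≡r = r≢0 (trans (sym x%m≡r) (n∣m⇒m%n≡0 _ m m∣x))

  residueCount-self : ∀ n → residueCount (n % m) [ n % m ] ≡ 1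
  residueCount-self n = count-singleton (hasResidue? (n % m)) (m%n%n≡m%n n m)

  SP-multiples : ∀ {n xs} → SP m n xs → m ∣ n → All (m ∣_) xs
  SP-multiples (base _ _)               m∣n = m∣n ∷ []
  SP-multiples (scale {λ′ = xs} _ _ _)  _   = map⁺ (universal m∣m*n xs)
  SP-multiples (consL _ n%m≢0 _)        m∣n = contradiction (n∣m⇒m%n≡0 _ m m∣n) n%m≢0
  SP-multiples (consR _ n%m≢0 _)        m∣n = contradiction (n∣m⇒m%n≡0 _ m m∣n) n%m≢0
  SP-multiples (addm _ _ _ _ n%m≢0 _ _) m∣n = contradiction (n∣m⇒m%n≡0 _ m m∣n) n%m≢0

  residueCount-SP-multiples : ∀ {n xs} → n % m ≢ 0 → SP m (n ∸ n % m) xs → residueCount (n % m) xs ≡ 0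
  residueCount-SP-multiples {n} n%m≢0 sp = residueCount-multiples n%m≢0 (SP-multiples sp (m∣n∸n%m n))

  SP-residueCount : ∀ {n xs r} → SP m n xs → n % m ≡ r → r ≢ 0 → residueCount r xs ≡ 1
  SP-residueCount (base _ _) n%m≡r _ = count-singleton (hasResidue? _) n%m≡r
  SP-residueCount (scale _ n%m≡0 _) n%m≡r r≢0 = contradiction (trans (sym n%m≡r) n%m≡0) r≢0
  SP-residueCount {n} (consL {λ′ = xs} _ n%m≢0 sp) refl _ =
    trans (count-++ (hasResidue? (n % m)) [ n % m ] xs)
          (cong₂ _+_ (residueCount-self n) (residueCount-SP-multiples n%m≢0 sp))
  SP-residueCount {n} (consR {λ′ = xs} _ n%m≢0 sp) refl _ =
    trans (count-++ (hasResidue? (n % m)) xs [ n % m ])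
          (cong₂ _+_ (residueCount-SP-multiples n%m≢0 sp) (residueCount-self n))
  SP-residueCount (addm xs x ys m<n _ sp _) n%m≡r r≢0 = begin
    residueCount _ (xs ++ (x + m) ∷ ys) ≡⟨ count-replace (hasResidue? _) xs ys (residue-cong ([m+n]%n≡m%n x m)) ⟩
    residueCount _ (xs ++ x ∷ ys)       ≡⟨ SP-residueCount sp (trans (m≤n⇒[n∸m]%m≡n%m (<⇒≤ m<n)) n%m≡r) r≢0 ⟩
    1                                   ∎
    where open ≡-Reasoning

lemma2p1 : (m n : ℕ) .{{_ : NonZero m}} → 1 < m → 1 ≤ n → (λ′ : List ℕ) → SP m n λ′ →
    (m ∣ n → All (λ x → m ∣ x) λ′)
    × (∀ r → 1 ≤ r → r < m → n % m ≡ r → length (filter (λ x → x % m ≟ r) λ′) ≡ 1)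
lemma2p1 m n _ _ λ′ sp =
  SP-multiples sp , λ r 1≤r _ n%m≡r → SP-residueCount sp n%m≡r (m<n⇒n≢0 1≤r)
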